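{- Let $G$ be a finite simple graph that is odd hole free and full house free, is not of $T_{11}$-type, has no harmonious cutset, and has an induced subgraph isomorphic to the complement of a cycle on seven vertices. Let $(W_1,\dots,W_7)$ be a heptagram in $G$. Then for each $i\in\{1,\dots,7\}$, no two $Y$-vertices of type $i$ (with respect to this heptagram) are adjacent.
   Context: A hole is an induced cycle of length at least 4; an odd hole is one of odd length. A full house is $K_4$ plus a new vertex adjacent to exactly both ends of one edge of the $K_4$. A cutset is a set $X\subseteq V(G)$ with $G-X$ having more components than $G$; it is harmonious if it can be partitioned into $X_1,\dots,X_t$ such that if $t\ge3$ these are pairwise complete, and every induced path with exactly one vertex (an end) in $X_i$ and exactly one vertex (the other end) in $X_j$ is even if $i=j$ and odd otherwise. $G$ is of $T_{11}$-type if $V(G)$ partitions into nonempty stable sets $W_1,\dots,W_{11}$ with $W_i$ anticomplete to $W_{i+1}\cup W_{i+2}$ and complete to $W_{i+3}\cup W_{i+4}\cup W_{i+5}$ (indices mod 11). Sets $A,B$ are complete (anticomplete) if all (no) edges between them are present; linked if each vertex of each has a neighbor in the other. A heptagram $(W_1,\dots,W_7)$ in $G$ (indices mod 7) is a family of disjoint nonempty stable sets with: $W_i$ anticomplete to $W_{i+3}\cup W_{i+4}$; $W_i,W_{i+1},W_{i+2}$ pairwise linked; if $u\in W_{i-1},v\in W_i,w\in W_{i+1}$ and $v$ is adjacent to both $u,w$ then $uw\in E(G)$; if $u\in W_{i-1},v\in W_i,w\in W_{i+1}$ and $v$ is adjacent to neither $u$ nor $w$ then $uw\notin E(G)$; if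 $u\in W_{i-1},v\in W_i,w\in W_{i+1},x\in W_{i+2}$ and $uw,vx\in E(G)$ then $uv\in E(G)$ or $wx\in E(G)$. Let $W=\bigcup W_i$. A vertex $y\in V(G)\setminus W$ is a $Y$-vertex of type $t$ if, writing $N_i$ for the set of neighbors of $y$ in $W_i$: $N_t,N_{t+3},N_{t-3}$ are nonempty and $N_i=\emptyset$ for $i\in\{t-2,t-1,t+1,t+2\}$; $N_{t-3}$ is complete to $N_{t+3}$, $N_{t-3}$ is anticomplete to $W_{t+3}\setminus N_{t+3}$, and $N_{t+3}$ is anticomplete to $W_{t-3}\setminus N_{t-3}$; and $N_t$ is complete to $W_{t-1}\cup W_{t-2}\cup W_{t+1}\cup W_{t+2}$. -}

module Defs where

open import Data.Nat using (ℕ; zero; suc; _+_; _*_; _≤_; _<_; _%_)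
open import Data.Nat.Divisibility using (_∣_)
open import Data.Bool using (Bool; true; false; not)
open import Data.Nat using (_≡ᵇ_)
open import Data.Fin using (Fin; toℕ; fromℕ)
open import Data.Maybe using (Maybe; just; nothing)
open import Data.Product using (Σ; ∃; _×_; _,_)
open import Data.Sum using (_⊎_)
open import Data.Unit using (⊤)
open import Relation.Nullary using (¬_)
open import Relation.Binary.PropositionalEquality using (_≡_; _≢_)
open import Function.Definitions using (Injective)

record Graph (n : ℕ) : Set where
  field
    adj    : Fin n → Fin n → Bool
    sym    : ∀ u v → adj u v ≡ adj v u
    irrefl : ∀ v → adj v v ≡ false

open Graph public

Adj : ∀ {n} → Graph n → Fin n → Fin n → Set
Adj G u v = adj G u v ≡ true

InducedCopy : ∀ {n} (G : Graph n) (m : ℕ) (H : Fin m → Fin m → Set) → Set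
InducedCopy {n} G m H =
  Σ (Fin m → Fin n) λ φ →
    Injective _≡_ _≡_ φ ×
    (∀ i j → Adj G (φ i) (φ j) → H i j) ×
    (∀ i j → H i j → Adj G (φ i) (φ j))

CycAdj : (k : ℕ) → Fin k → Fin k → Set
CycAdj k i j =
  (suc (toℕ i) ≡ toℕ j) ⊎ (suc (toℕ j) ≡ toℕ i) ⊎
  ((toℕ i ≡ 0) × (suc (toℕ j) ≡ k)) ⊎ ((toℕ j ≡ 0) × (suc (toℕ i) ≡ k))

C7barAdj : Fin 7 → Fin 7 → Set
C7barAdj i j = (i ≢ j) × ¬ CycAdj 7 i j

-- full house: K4 on {0,1,2,3}, plus vertex 4 adjacent exactly to 0 and 1
fhℕ : ℕ → ℕ → Bool
fhℕ 4 0 = true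
fhℕ 4 1 = true
fhℕ 0 4 = true
fhℕ 1 4 = true
fhℕ 4 _ = false
fhℕ _ 4 = false
fhℕ a b = not (a ≡ᵇ b)

FullHouseAdj : Fin 5 → Fin 5 → Set
FullHouseAdj i j = fhℕ (toℕ i) (toℕ j) ≡ true

FullHouseFree : ∀ {n} → Graph n → Set
FullHouseFree G = ¬ InducedCopy G 5 FullHouseAdj

Hole : ∀ {n} → Graph n → (k : ℕ) → (Fin k → Fin n) → Set
Hole G k c =
  4 ≤ k × Injective _≡_ _≡_ c ×
  (∀ i j → Adj G (c i) (c j) → CycAdj k i j) ×
  (∀ i j → CycAdj k i j → Adj G (c i) (c j))

OddHoleFree : ∀ {n} → Graph n → Set
OddHoleFree {n} G = ∀ k (c : Fin k → Fin n) → Hole G k c → 2 ∣ k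

-- Induced paths: p 0, ..., p k (length k = number of edges)

PathAdj : ∀ {m} → Fin m → Fin m → Set
PathAdj i j = (suc (toℕ i) ≡ toℕ j) ⊎ (suc (toℕ j) ≡ toℕ i)

InducedPath : ∀ {n} → Graph n → (k : ℕ) → (Fin (suc k) → Fin n) → Set
InducedPath G k p =
  Injective _≡_ _≡_ p ×
  (∀ i j → Adj G (p i) (p j) → PathAdj i j) ×
  (∀ i j → PathAdj i j → Adj G (p i) (p j))

data Reach {n} (G : Graph n) (S : Fin n → Set) (u : Fin n) : Fin n → Set where
  here : S u → Reach G S u u
  step : ∀ {w v} → Reach G S u w → Adj G w v → S v → Reach G S u v

-- f picks m vertices of S lying in pairwise distinct components of G[S]
Separated : ∀ {n} → Graph n → (Fin n → Set) → (m : ℕ) → (Fin m → Fin n) → Set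
Separated G S m f =
  (∀ i → S (f i)) × (∀ i j → i ≢ j → ¬ Reach G S (f i) (f j))

-- The number of components of G[S] is the maximum m admitting such an f.
-- X is a cutset iff G - X has more components than G.
Cutset : ∀ {n} → Graph n → (Fin n → Set) → Set
Cutset {n} G X =
  Σ ℕ λ m → Σ (Fin m → Fin n) λ f →
    Separated G (λ v → ¬ X v) m f ×
    (∀ m' (f' : Fin m' → Fin n) → Separated G (λ _ → ⊤) m' f' → m' < m)

InX : ∀ {n t} → (Fin n → Maybe (Fin t)) → Fin n → Set
InX {t = t} part v = Σ (Fin t) λ i → part v ≡ just i

-- harmonious cutset, with partition X_1..X_t given by part (v ∈ X_i iff part v = just i)
Harmonious : ∀ {n} → Graph n → (t : ℕ) → (Fin n → Maybe (Fin t)) → Set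
Harmonious {n} G t part =
  Cutset G (InX part) ×
  (∀ i → ∃ λ v → part v ≡ just i) ×
  (3 ≤ t → ∀ u v i j → i ≢ j → part u ≡ just i → part v ≡ just j → Adj G u v) ×
  (∀ k (p : Fin (suc k) → Fin n) i j →
     InducedPath G k p → 1 ≤ k →
     part (p Data.Fin.zero) ≡ just i → part (p (fromℕ k)) ≡ just j →
     (∀ r → 0 < toℕ r → toℕ r < k → part (p r) ≢ just i × part (p r) ≢ just j) →
     (i ≡ j → 2 ∣ k) × (i ≢ j → ¬ (2 ∣ k)))

HasHarmoniousCutset : ∀ {n} → Graph n → Set
HasHarmoniousCutset {n} G =
  Σ ℕ λ t → Σ (Fin n → Maybe (Fin t)) λ part → Harmonious G t part

T11Type : ∀ {n} → Graph n → Set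
T11Type {n} G =
  Σ (Fin n → Fin 11) λ cls →
    (∀ i → ∃ λ v → cls v ≡ i) ×
    (∀ u v → cls u ≡ cls v → ¬ Adj G u v) ×
    (∀ u v d → (d ≡ 1 ⊎ d ≡ 2) →
       toℕ (cls v) ≡ (toℕ (cls u) + d) % 11 → ¬ Adj G u v) ×
    (∀ u v d → (d ≡ 3 ⊎ d ≡ 4 ⊎ d ≡ 5) →
       toℕ (cls v) ≡ (toℕ (cls u) + d) % 11 → Adj G u v)

-- Heptagrams: h v = just j means v ∈ W_j (j ∈ Fin 7, indices mod 7);
-- h v = nothing means v ∉ W.

Wh : ∀ {n} → (Fin n → Maybe (Fin 7)) → ℕ → Fin n → Set
Wh h i v = Σ (Fin 7) λ j → (h v ≡ just j) × (toℕ j ≡ i % 7)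

Complete : ∀ {n} → Graph n → (Fin n → Set) → (Fin n → Set) → Set
Complete G A B = ∀ a b → A a → B b → Adj G a b

Anticomplete : ∀ {n} → Graph n → (Fin n → Set) → (Fin n → Set) → Set
Anticomplete G A B = ∀ a b → A a → B b → ¬ Adj G a b

Linked : ∀ {n} → Graph n → (Fin n → Set) → (Fin n → Set) → Set
Linked G A B =
  (∀ a → A a → ∃ λ b → B b × Adj G a b) ×
  (∀ b → B b → ∃ λ a → A a × Adj G a b)

Heptagram : ∀ {n} → Graph n → (Fin n → Maybe (Fin 7)) → Set
Heptagram G h =
  (∀ i → ∃ λ v → Wh h i v) ×
  (∀ i → Anticomplete G (Wh h i) (Wh h i)) ×
  (∀ i → Anticomplete G (Wh h i) (Wh h (i + 3)) ×
         Anticomplete G (Wh h i) (Wh h (i + 4))) ×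
  (∀ i → Linked G (Wh h i) (Wh h (i + 1)) ×
         Linked G (Wh h i) (Wh h (i + 2)) ×
         Linked G (Wh h (i + 1)) (Wh h (i + 2))) ×
  -- here i-1, i, i+1 are written i, i+1, i+2
  (∀ i u v w → Wh h i u → Wh h (i + 1) v → Wh h (i + 2) w →
     Adj G v u → Adj G v w → Adj G u w) ×
  (∀ i u v w → Wh h i u → Wh h (i + 1) v → Wh h (i + 2) w →
     ¬ Adj G v u → ¬ Adj G v w → ¬ Adj G u w) ×
  (∀ i u v w x → Wh h i u → Wh h (i + 1) v → Wh h (i + 2) w → Wh h (i + 3) x →
     Adj G u w → Adj G v x → Adj G u v ⊎ Adj G w x)

Nb : ∀ {n} → Graph n → (Fin n → Maybe (Fin 7)) → Fin n → ℕ → Fin n → Set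
Nb G h y i v = Wh h i v × Adj G y v

-- Y-vertex of type t (t-k written t+(7-k))
YVertex : ∀ {n} → Graph n → (Fin n → Maybe (Fin 7)) → ℕ → Fin n → Set
YVertex G h t y =
  (h y ≡ nothing) ×
  (∃ λ v → Nb G h y t v) ×
  (∃ λ v → Nb G h y (t + 3) v) ×
  (∃ λ v → Nb G h y (t + 4) v) ×
  (∀ v → ¬ Nb G h y (t + 5) v) ×
  (∀ v → ¬ Nb G h y (t + 6) v) ×
  (∀ v → ¬ Nb G h y (t + 1) v) ×
  (∀ v → ¬ Nb G h y (t + 2) v) ×
  Complete G (Nb G h y (t + 4)) (Nb G h y (t + 3)) ×
  Anticomplete G (Nb G h y (t + 4)) (λ v → Wh h (t + 3) v × ¬ Nb G h y (t + 3) v) ×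
  Anticomplete G (Nb G h y (t + 3)) (λ v → Wh h (t + 4) v × ¬ Nb G h y (t + 4) v) ×
  Complete G (Nb G h y t)
    (λ v → Wh h (t + 6) v ⊎ Wh h (t + 5) v ⊎ Wh h (t + 1) v ⊎ Wh h (t + 2) v)

-- Let y, y' be adjacent Y-vertices of type t, with neighbours b and b' in W_{t+3}.
-- If y' ~ b, then y and y' also share a neighbour c in W_{t+4}, so y, y', b, c is a K₄.
-- The two vertices also share a neighbour in W_t, since otherwise they close a 5-hole
-- with their neighbours in W_t and any vertex of W_{t+1}; this common neighbour sees
-- neither b nor c, so the K₄ extends to a full house. The case y ~ b' is symmetric.
-- If neither holds, the heptagram axioms yield z ∈ W_{t+1} adjacent to both b and b',
-- and z b y y' b' is a 5-hole.
module Submission where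

open import Defs
open import Data.Nat using (ℕ; suc; _+_)
import Data.Nat.Properties as ℕ
open import Data.Nat.Divisibility using (_∣?_)
open import Data.Fin using (Fin; toℕ; _<_)
open import Data.Fin.Properties using (all?; <-cmp; _<?_; _≟_)
open import Data.Bool using (true; false)
import Data.Bool.Properties as Bool
open import Data.List using (List; filter; cartesianProduct; allFin)
open import Data.List.Relation.Unary.All using (All; []; _∷_; lookup)
open import Data.List.Membership.Propositional.Properties
  using (∈-filter⁺; ∈-cartesianProduct⁺; ∈-allFin)
import Data.Vec as Vec
open import Data.Vec using (_∷_; [])
open import Data.Maybe using (Maybe)
open import Data.Product using (∃; _×_; _,_; proj₁; proj₂; uncurry)
open import Data.Sum using (inj₁; inj₂)
open import Data.Empty using (⊥; ⊥-elim)
open import Function.Definitions using (Injective)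
open import Relation.Nullary using (¬_; Dec; yes; no; does; contradiction)
open import Relation.Nullary.Decidable
  using (_⊎-dec_; _×-dec_; _→-dec_; ¬?; from-yes; from-no; dec-true; dec-false; does-⇔)
open import Relation.Binary using (Decidable; Symmetric; tri<; tri≈; tri>)
open import Function.Bundles using (mk⇔)
import Relation.Binary.PropositionalEquality as ≡
open ≡ using (_≡_; refl)

module GraphFacts {n} (G : Graph n) where

  Adj-sym : ∀ {u v} → Adj G u v → Adj G v u
  Adj-sym {u} {v} = ≡.trans (sym G v u)

  ¬Adj-sym : ∀ {u v} → ¬ Adj G u v → ¬ Adj G v u
  ¬Adj-sym ¬uv vu = ¬uv (Adj-sym vu)

  Adj? : Decidable (Adj G)
  Adj? u v = adj G u v Bool.≟ true

  ¬Adj⇒adj≡false : ∀ {u v} → ¬ Adj G u v → adj G u v ≡ false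
  ¬Adj⇒adj≡false = Bool.¬-not

open GraphFacts

does≡true⇒ : ∀ {A : Set} (a? : Dec A) → does a? ≡ true → A
does≡true⇒ (yes a) _  = a
does≡true⇒ (no _)  ()

IsInducedEmbedding : ∀ {n m} → Graph n → (Fin m → Fin m → Set) → (Fin m → Fin n) → Set
IsInducedEmbedding G H c =
  Injective _≡_ _≡_ c ×
  (∀ i j → Adj G (c i) (c j) → H i j) ×
  (∀ i j → H i j → Adj G (c i) (c j))

NoFalseTwins : ∀ {m} {H : Fin m → Fin m → Set} → Decidable H → Set
NoFalseTwins H? = ∀ i i' → (∀ k → does (H? i k) ≡ does (H? i' k)) → i ≡ i'

noFalseTwins? : ∀ {m} {H : Fin m → Fin m → Set} (H? : Decidable H) → Dec (NoFalseTwins H?)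
noFalseTwins? H? =
  all? λ i → all? λ i' → all? (λ k → does (H? i k) Bool.≟ does (H? i' k)) →-dec (i ≟ i')

upperPairs : (m : ℕ) → List (Fin m × Fin m)
upperPairs m = filter (uncurry _<?_) (cartesianProduct (allFin m) (allFin m))

-- For concrete m, upperPairs m normalises to the pairs i < j in lexicographic order, so the
-- hypothesis of realised-upper⇒induced is met by an explicit list of (non-)adjacencies.
module InducedPattern {m} {H : Fin m → Fin m → Set} (H? : Decidable H)
  (H-sym : Symmetric H) (H-irrefl : ∀ i → ¬ H i i) (twinless : NoFalseTwins H?)
  {n} (G : Graph n) (c : Fin m → Fin n) where

  RealisedOn : Fin m × Fin m → Set
  RealisedOn (i , j) = adj G (c i) (c j) ≡ does (H? i j)

  module _ (upper : All RealisedOn (upperPairs m)) where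

    realised-below : ∀ {i j} → i < j → RealisedOn (i , j)
    realised-below {i} {j} i<j =
      lookup upper (∈-filter⁺ (uncurry _<?_) (∈-cartesianProduct⁺ (∈-allFin i) (∈-allFin j)) i<j)

    realised : ∀ i j → RealisedOn (i , j)
    realised i j with <-cmp i j
    ... | tri< i<j _ _ = realised-below i<j
    ... | tri≈ _ refl _ = ≡.trans (irrefl G (c i)) (≡.sym (dec-false (H? i i) (H-irrefl i)))
    ... | tri> _ _ j<i = ≡.trans (sym G (c i) (c j))
                           (≡.trans (realised-below j<i) (does-⇔ (mk⇔ H-sym H-sym) (H? j i) (H? i j)))

    injective : Injective _≡_ _≡_ c
    injective {i} {i'} ci≡ci' = twinless i i' λ k →
      ≡.trans (≡.sym (realised i k)) (≡.trans (≡.cong (λ v → adj G v (c k)) ci≡ci') (realised i' k))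

    realised-upper⇒induced : IsInducedEmbedding G H c
    realised-upper⇒induced =
      injective ,
      (λ i j ij → does≡true⇒ (H? i j) (≡.trans (≡.sym (realised i j)) ij)) ,
      (λ i j Hij → ≡.trans (realised i j) (dec-true (H? i j) Hij))

CycAdj? : ∀ k → Decidable (CycAdj k)
CycAdj? k i j = (suc (toℕ i) ℕ.≟ toℕ j) ⊎-dec (suc (toℕ j) ℕ.≟ toℕ i) ⊎-dec
  ((toℕ i ℕ.≟ 0) ×-dec (suc (toℕ j) ℕ.≟ k)) ⊎-dec ((toℕ j ℕ.≟ 0) ×-dec (suc (toℕ i) ℕ.≟ k))

CycAdj-sym : ∀ {k} → Symmetric (CycAdj k)
CycAdj-sym (inj₁ e)               = inj₂ (inj₁ e)
CycAdj-sym (inj₂ (inj₁ e))        = inj₁ e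
CycAdj-sym (inj₂ (inj₂ (inj₁ e))) = inj₂ (inj₂ (inj₂ e))
CycAdj-sym (inj₂ (inj₂ (inj₂ e))) = inj₂ (inj₂ (inj₁ e))

module C₅ = InducedPattern (CycAdj? 5) CycAdj-sym
  (from-yes (all? λ i → ¬? (CycAdj? 5 i i))) (from-yes (noFalseTwins? (CycAdj? 5)))

FullHouseAdj? : Decidable FullHouseAdj
FullHouseAdj? i j = fhℕ (toℕ i) (toℕ j) Bool.≟ true

module FullHouse = InducedPattern FullHouseAdj?
  (λ {i} {j} → from-yes (all? λ i → all? λ j → FullHouseAdj? i j →-dec FullHouseAdj? j i) i j)
  (from-yes (all? λ i → ¬? (FullHouseAdj? i i))) (from-yes (noFalseTwins? FullHouseAdj?))

module _ {n} (G : Graph n) where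

  no-induced-C₅ : OddHoleFree G → ∀ v₀ v₁ v₂ v₃ v₄ →
    Adj G v₀ v₁ → Adj G v₁ v₂ → Adj G v₂ v₃ → Adj G v₃ v₄ → Adj G v₄ v₀ →
    ¬ Adj G v₀ v₂ → ¬ Adj G v₀ v₃ → ¬ Adj G v₁ v₃ → ¬ Adj G v₁ v₄ → ¬ Adj G v₂ v₄ → ⊥
  no-induced-C₅ ohf v₀ v₁ v₂ v₃ v₄ e₀₁ e₁₂ e₂₃ e₃₄ e₄₀ n₀₂ n₀₃ n₁₃ n₁₄ n₂₄ =
    from-no (2 ∣? 5) (ohf 5 c (ℕ.n≤1+n 4 , C₅.realised-upper⇒induced G c
      (e₀₁ ∷ ¬Adj⇒adj≡false G n₀₂ ∷ ¬Adj⇒adj≡false G n₀₃ ∷ Adj-sym G e₄₀ ∷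
       e₁₂ ∷ ¬Adj⇒adj≡false G n₁₃ ∷ ¬Adj⇒adj≡false G n₁₄ ∷
       e₂₃ ∷ ¬Adj⇒adj≡false G n₂₄ ∷
       e₃₄ ∷ [])))
    where
    c : Fin 5 → Fin n
    c = Vec.lookup (v₀ ∷ v₁ ∷ v₂ ∷ v₃ ∷ v₄ ∷ [])

  no-full-house : FullHouseFree G → ∀ v₀ v₁ v₂ v₃ v₄ →
    Adj G v₀ v₁ → Adj G v₀ v₂ → Adj G v₀ v₃ → Adj G v₁ v₂ → Adj G v₁ v₃ → Adj G v₂ v₃ →
    Adj G v₄ v₀ → Adj G v₄ v₁ → ¬ Adj G v₄ v₂ → ¬ Adj G v₄ v₃ → ⊥
  no-full-house fhf v₀ v₁ v₂ v₃ v₄ e₀₁ e₀₂ e₀₃ e₁₂ e₁₃ e₂₃ e₄₀ e₄₁ n₄₂ n₄₃ =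
    fhf (c , FullHouse.realised-upper⇒induced G c
      (e₀₁ ∷ e₀₂ ∷ e₀₃ ∷ Adj-sym G e₄₀ ∷
       e₁₂ ∷ e₁₃ ∷ Adj-sym G e₄₁ ∷
       e₂₃ ∷ ¬Adj⇒adj≡false G (¬Adj-sym G n₄₂) ∷
       ¬Adj⇒adj≡false G (¬Adj-sym G n₄₃) ∷ []))
    where
    c : Fin 5 → Fin n
    c = Vec.lookup (v₀ ∷ v₁ ∷ v₂ ∷ v₃ ∷ v₄ ∷ [])

Wh-assoc : ∀ {n} (h : Fin n → Maybe (Fin 7)) i a b {v} → Wh h (i + (a + b)) v → Wh h (i + a + b) v
Wh-assoc h i a b {v} = ≡.subst (λ k → Wh h k v) (≡.sym (ℕ.+-assoc i a b))

module _ {n} (G : Graph n) (h : Fin n → Maybe (Fin 7)) where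

  transfer-neighbour : Heptagram G h → ∀ i {z b b' c} →
    Wh h i z → Wh h (i + 2) b → Wh h (i + 2) b' → Wh h (i + 3) c →
    Adj G b c → ¬ Adj G b' c → Adj G z b' → Adj G z b
  transfer-neighbour (_ , _ , _ , linked , triangle , _ , square) i {z} {b} {b'} {c}
    zW bW b'W cW bc ¬b'c zb' with proj₂ (proj₂ (proj₂ (linked i))) b bW
  ... | x , xW , xb = triangle i z x b zW xW bW (Adj-sym G zx) xb
    where
    xc : Adj G x c
    xc = triangle (i + 1) x b c xW (Wh-assoc h i 1 1 bW) (Wh-assoc h i 1 2 cW) (Adj-sym G xb) bc

    zx : Adj G z x
    zx with square i z x b' c zW xW b'W cW zb' xc
    ... | inj₁ zx  = zx
    ... | inj₂ b'c = contradiction b'c ¬b'c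

-- Nᵢ stands for the neighbourhood of a Y-vertex in W_{T+i}; thus N₄ is the paper's N_{t-3}.
module SameTypeYVertices {n} (G : Graph n) (h : Fin n → Maybe (Fin 7)) (T : ℕ) where

  common-N₀ : OddHoleFree G → Heptagram G h → ∀ {y y'} →
    YVertex G h T y → YVertex G h T y' → Adj G y y' → ∃ λ a → Nb G h y T a × Adj G y' a
  common-N₀ ohf (nonempty , stable , _) {y} {y'}
    (_ , (a , aW , ya) , _ , _ , _ , _ , noN₁ , _ , _ , _ , _ , N₀-complete)
    (_ , (a' , a'W , y'a') , _ , _ , _ , _ , noN₁' , _ , _ , _ , _ , N₀'-complete) yy'
    with Adj? G y' a | Adj? G y a'
  ... | yes y'a | _      = a , (aW , ya) , y'a
  ... | no _    | yes ya' = a' , (a'W , ya') , y'a'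
  ... | no ¬y'a | no ¬ya' with nonempty (T + 1)
  ...   | w , wW = ⊥-elim (no-induced-C₅ G ohf a y y' a' w
          (Adj-sym G ya) yy' y'a' (N₀'-complete a' w (a'W , y'a') (inj₂ (inj₂ (inj₁ wW))))
          (Adj-sym G (N₀-complete a w (aW , ya) (inj₂ (inj₂ (inj₁ wW)))))
          (¬Adj-sym G ¬y'a) (stable T a a' aW a'W) ¬ya'
          (λ yw → noN₁ w (wW , yw)) (λ y'w → noN₁' w (wW , y'w)))

  no-common-N₃-N₄ : OddHoleFree G → FullHouseFree G → Heptagram G h → ∀ {y y' p q} →
    YVertex G h T y → YVertex G h T y' → Adj G y y' →
    Nb G h y (T + 3) p → Adj G y' p → Nb G h y (T + 4) q → Adj G y' q → ⊥
  no-common-N₃-N₄ ohf fhf Hp@(_ , _ , anticomplete , _) {y} {y'} {p} {q}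
    Y@(_ , _ , _ , _ , _ , _ , _ , _ , N₄-complete-N₃ , _) Y' yy' (pW , yp) y'p (qW , yq) y'q
    with common-N₀ ohf Hp Y Y' yy'
  ... | a , (aW , ya) , y'a = no-full-house G fhf y y' p q a
          yy' yp yq y'p y'q (Adj-sym G (N₄-complete-N₃ q p (qW , yq) (pW , yp)))
          (Adj-sym G ya) (Adj-sym G y'a)
          (proj₁ (anticomplete T) a p aW pW) (proj₂ (anticomplete T) a q aW qW)

  shared-N₃⇒shared-N₄ : ∀ {y y' b c'} → YVertex G h T y → YVertex G h T y' →
    Nb G h y (T + 3) b → Adj G y' b → Nb G h y' (T + 4) c' → Nb G h y (T + 4) c'
  shared-N₃⇒shared-N₄ {y} {b = b} {c'}
    (_ , _ , _ , _ , _ , _ , _ , _ , _ , _ , N₃-anticomplete-W₄∖N₄ , _)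
    (_ , _ , _ , _ , _ , _ , _ , _ , N₄'-complete-N₃' , _) (bW , yb) y'b (c'W , y'c')
    with Adj? G y c'
  ... | yes yc' = c'W , yc'
  ... | no ¬yc' = contradiction (Adj-sym G (N₄'-complete-N₃' c' b (c'W , y'c') (bW , y'b)))
                    (N₃-anticomplete-W₄∖N₄ b c' (bW , yb) (c'W , λ yc' → ¬yc' (proj₂ yc')))

  no-private-N₃ : OddHoleFree G → Heptagram G h → ∀ {y y' b b'} →
    YVertex G h T y → YVertex G h T y' → Adj G y y' →
    Nb G h y (T + 3) b → Nb G h y' (T + 3) b' → ¬ Adj G y' b → ¬ Adj G y b' → ⊥
  no-private-N₃ ohf Hp@(_ , stable , _ , linked , _) {y} {y'} {b} {b'}
    (_ , _ , _ , (c , cW , yc) , _ , _ , noN₁ , _ , N₄-complete-N₃ , N₄-anticomplete-W₃∖N₃ , _)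
    (_ , _ , _ , _ , _ , _ , noN₁' , _) yy' (bW , yb) (b'W , y'b') ¬y'b ¬yb'
    with proj₂ (proj₁ (proj₂ (linked (T + 1)))) b' (Wh-assoc h T 1 2 b'W)
  ... | z , zW , zb' = no-induced-C₅ G ohf z b y y' b'
          zb (Adj-sym G yb) yy' y'b' (Adj-sym G zb')
          (λ zy → noN₁ z (zW , Adj-sym G zy)) (λ zy' → noN₁' z (zW , Adj-sym G zy'))
          (¬Adj-sym G ¬y'b) (stable (T + 3) b b' bW b'W) ¬yb'
    where
    bc : Adj G b c
    bc = Adj-sym G (N₄-complete-N₃ c b (cW , yc) (bW , yb))

    ¬b'c : ¬ Adj G b' c
    ¬b'c = ¬Adj-sym G (N₄-anticomplete-W₃∖N₃ c b' (cW , yc) (b'W , λ yb' → ¬yb' (proj₂ yb')))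

    zb : Adj G z b
    zb = transfer-neighbour G h Hp (T + 1) zW
           (Wh-assoc h T 1 2 bW) (Wh-assoc h T 1 2 b'W) (Wh-assoc h T 1 3 cW) bc ¬b'c zb'

  nonadjacent : OddHoleFree G → FullHouseFree G → Heptagram G h → ∀ {y y'} →
    YVertex G h T y → YVertex G h T y' → ¬ Adj G y y'
  nonadjacent ohf fhf Hp {y} {y'}
    Y@(_ , _ , (b , bN) , (_ , cN) , _) Y'@(_ , _ , (b' , b'N) , (_ , c'N) , _) yy'
    with Adj? G y' b | Adj? G y b'
  ... | yes y'b | _ = no-common-N₃-N₄ ohf fhf Hp Y Y' yy'
                        bN y'b (shared-N₃⇒shared-N₄ Y Y' bN y'b c'N) (proj₂ c'N)
  ... | no _ | yes yb' = no-common-N₃-N₄ ohf fhf Hp Y' Y (Adj-sym G yy')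
                           b'N yb' (shared-N₃⇒shared-N₄ Y' Y b'N yb' cN) (proj₂ cN)
  ... | no ¬y'b | no ¬yb' = no-private-N₃ ohf Hp Y Y' yy' bN b'N ¬y'b ¬yb'

lemma3p6 : (n : ℕ) (G : Graph n) →
    OddHoleFree G → FullHouseFree G → ¬ T11Type G → ¬ HasHarmoniousCutset G →
    InducedCopy G 7 C7barAdj →
    (h : Fin n → Maybe (Fin 7)) → Heptagram G h →
    (t : Fin 7) (y y' : Fin n) →
    YVertex G h (toℕ t) y → YVertex G h (toℕ t) y' → ¬ Adj G y y'
lemma3p6 n G ohf fhf _ _ _ h Hp t y y' =
  SameTypeYVertices.nonadjacent G h (toℕ t) ohf fhf Hp
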